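{- Let $C$ be a caterpillar with $m$ edges, let $P=(v_0,\dots,v_p)$ be a longest path in $C$, and let $\phi$, $E_0$, $E_1$, $U_i$, $F_0$, $E_2$ be as defined in the context (the labeling $\phi$ produced by the algorithm described there). Then for every $i\in\{1,\dots,p\}$, $$\phi(e_i)=\begin{cases}\lceil i/2\rceil+|U_i| & \text{if } e_i\in E_0,\\ m-\lfloor p/2\rfloor+\lceil i/2\rceil & \text{if } e_i\in E_1.\end{cases}$$ Moreover: (1) $\phi(E_0\cup F_0)=[1,\lceil p/2\rceil+|U_p|]\subseteq L_0$; (2) $\phi(E_1)=L_1=[m-\lfloor p/2\rfloor+1,m]$; (3) $\phi(E_2)=[\lceil p/2\rceil+|U_p|+1,\, m-\lfloor p/2\rfloor]\subseteq L_0$.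
   Context: For integers $a\le b$, $[a,b]=\{n\in\mathbb{N}: a\le n\le b\}$. A caterpillar is a tree of order at least $3$ whose removal of leaves yields a path. Let $C$ have $m$ edges and let $P=(v_0,\dots,v_p)$ be a longest path in $C$; write $e_i=\{v_{i-1},v_i\}$ ($1\le i\le p$) for the path edges; edges not on $P$ are legs, and for a vertex $v_k$ of degree $3$ ($1\le k\le p-1$) let $f_k$ be its unique leg. Let $E_0=\{e_i: i\equiv p \pmod 2\}$ and $E_1=\{e_i: i\not\equiv p\pmod 2\}$. Let $L_0=[1,m-\lfloor p/2\rfloor]$ and $L_1=[m-\lfloor p/2\rfloor+1,m]$. The labeling $\phi$ is built as follows. Step 1: if $p$ is odd set $\phi(e_1)=1$, $\phi(e_2)=m-\lfloor p/2\rfloor+1$; if $p$ is even set $\phi(e_1)=m-\lfloor p/2\rfloor+1$, $\phi(e_2)=1$. Set $U_1=U_2=\emptyset$. For $i=3,\dots,p$ in order: set $\phi(e_i)=\phi(e_{i-2})+1$ and $U_i=U_{i-1}$; then, if $i\equiv p\pmod 2$ and there is some $k\in\{1,\dots,i-3\}$ with $d(v_k)=3$ and $\phi(e_{i-1})=\phi(e_k)+\phi(e_{k+1})$, then for such a $k$ set $\phi(f_k)=\phi(e_{i-2})+1$, redefine $\phi(e_i)=\phi(e_{i-2})+2$, and set $U_i=U_{i-1}\cup\{v_k\}$. Vertices in $U_p$ are called light; vertices of degree at least $3$ not in $U_p$ are heavy. Let $F_0=\{f_k: v_k\in U_p\}$ and let $E_2=E(C)\setminus(E_0\cup E_1\cup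 F_0)$. Step 2: for each heavy vertex, assign to all but one of its legs arbitrary distinct not-yet-used labels from $L_0$. Step 3: order the heavy vertices $w_1,\dots,w_t$ so that their current partial vertex sums (sum of labels assigned so far on incident edges) are nondecreasing, order the remaining unused labels of $L_0$ increasingly as $\ell_1<\dots<\ell_t$, and assign $\ell_i$ to the remaining unlabeled leg of $w_i$. -}

module Defs where

open import Data.Nat using (ℕ; zero; suc; _+_; _∸_; _≤_; _<_; _≡ᵇ_; ⌊_/2⌋; ⌈_/2⌉)
open import Data.Nat.DivMod using (_%_)
open import Data.Bool using (Bool; true; false; if_then_else_; _∨_)
open import Data.Maybe using (Maybe; just; nothing)
open import Data.Fin using (Fin) renaming (_≤_ to _≤ᶠ_; _<_ to _<ᶠ_)
open import Data.Product using (Σ; ∃; _×_)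
open import Data.Sum using (_⊎_)
open import Relation.Nullary using (¬_)
open import Relation.Binary.PropositionalEquality using (_≡_; _≢_)
open import Function.Bundles using (_⇔_)

-- Up to isomorphism, a caterpillar C with a chosen longest path
-- P = (v_0,…,v_p) is exactly: the path v_0 … v_p (p ≥ 2, since C is a
-- tree of order ≥ 3) together with, for every internal vertex v_k
-- (1 ≤ k ≤ p-1), some number  legs k  of pendant edges (legs) v_k–leaf.
-- (The end vertices v_0, v_p are leaves because P is longest.)
-- Values  legs k  for k ∉ [1, p-1] are irrelevant and never used.
--
-- Edges:  path edge  e_i = {v_{i-1}, v_i}  for 1 ≤ i ≤ p,
--         leg number j (0 ≤ j < legs k) at v_k, for 1 ≤ k ≤ p-1.

record Caterpillar : Set where
  field
    p    : ℕ
    2≤p  : 2 ≤ p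
    legs : ℕ → ℕ
open Caterpillar public

sumFrom : ℕ → ℕ → (ℕ → ℕ) → ℕ
sumFrom a zero    f = 0
sumFrom a (suc n) f = f a + sumFrom (suc a) n f

edges : Caterpillar → ℕ
edges C = p C + sumFrom 1 (p C ∸ 1) (legs C)

deg : Caterpillar → ℕ → ℕ
deg C zero = 1
deg C (suc k) = if suc k ≡ᵇ p C then 1 else 2 + legs C (suc k)

IsPathEdge : Caterpillar → ℕ → Set
IsPathEdge C i = 1 ≤ i × i ≤ p C

IsInternal : Caterpillar → ℕ → Set
IsInternal C k = 1 ≤ k × k < p C

IsLeg : Caterpillar → ℕ → ℕ → Set
IsLeg C k j = IsInternal C k × j < legs C k

-- e_i ∈ E_0  iff  i ≡ p (mod 2)
SameParity : ℕ → ℕ → Set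
SameParity i q = i % 2 ≡ q % 2

InL0 : Caterpillar → ℕ → Set
InL0 C x = 1 ≤ x × x ≤ edges C ∸ ⌊ p C /2⌋

InL1 : Caterpillar → ℕ → Set
InL1 C x = suc (edges C ∸ ⌊ p C /2⌋) ≤ x × x ≤ edges C

-- An edge labeling: labels of path edges  e_i  and of legs (k , j).
-- (Values outside the actual edge set are irrelevant.)

record Labeling : Set where
  field
    onPath : ℕ → ℕ
    onLeg  : ℕ → ℕ → ℕ
open Labeling public

-- Step 1.  A run of Step 1 is determined by the sequence of choices
-- ch : ℕ → Maybe ℕ, where  ch i = just k  means that at iteration i the
-- vertex v_k was chosen (and added to U_i), and  ch i = nothing  means
-- that the "if" clause did not fire at iteration i.

isOdd : ℕ → Bool
isOdd n = n % 2 ≡ᵇ 1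

bump : Maybe ℕ → ℕ
bump nothing  = 0
bump (just _) = 1

pathLabel : Caterpillar → (ℕ → Maybe ℕ) → ℕ → ℕ
pathLabel C ch zero = 0
pathLabel C ch (suc zero) =
  if isOdd (p C) then 1 else suc (edges C ∸ ⌊ p C /2⌋)
pathLabel C ch (suc (suc zero)) =
  if isOdd (p C) then suc (edges C ∸ ⌊ p C /2⌋) else 1
pathLabel C ch (suc (suc (suc n))) =
  pathLabel C ch (suc n) + 1 + bump (ch (suc (suc (suc n))))

Candidate : Caterpillar → (ℕ → Maybe ℕ) → ℕ → ℕ → Set
Candidate C ch i k =
  1 ≤ k × k ≤ i ∸ 3 × deg C k ≡ 3
  × pathLabel C ch (i ∸ 1) ≡ pathLabel C ch k + pathLabel C ch (suc k)

record ValidChoices (C : Caterpillar) (ch : ℕ → Maybe ℕ) : Set where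
  field
    chosen    : ∀ i k → ch i ≡ just k →
                3 ≤ i × i ≤ p C × SameParity i (p C) × Candidate C ch i k
    notChosen : ∀ i → 3 ≤ i → i ≤ p C → SameParity i (p C) →
                ch i ≡ nothing → ∀ k → ¬ Candidate C ch i k

isJustEq : Maybe ℕ → ℕ → Bool
isJustEq nothing  k = false
isJustEq (just j) k = j ≡ᵇ k

inU : (ℕ → Maybe ℕ) → ℕ → ℕ → Bool
inU ch zero    k = isJustEq (ch zero) k
inU ch (suc i) k = inU ch i k ∨ isJustEq (ch (suc i)) k

countFrom : ℕ → ℕ → (ℕ → Bool) → ℕ
countFrom a zero      b = 0
countFrom a (suc len) b = (if b a then 1 else 0) + countFrom (suc a) len b

-- |U_i|  (U_i ⊆ {v_0,…,v_p})
cardU : Caterpillar → (ℕ → Maybe ℕ) → ℕ → ℕ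
cardU C ch i = countFrom 0 (suc (p C)) (inU ch i)

Light : Caterpillar → (ℕ → Maybe ℕ) → ℕ → Set
Light C ch k = inU ch (p C) k ≡ true

Heavy : Caterpillar → (ℕ → Maybe ℕ) → ℕ → Set
Heavy C ch k = IsInternal C k × 3 ≤ deg C k × inU ch (p C) k ≡ false

record Produced (C : Caterpillar) (φ : Labeling) : Set where
  field
    ch       : ℕ → Maybe ℕ
    valid    : ValidChoices C ch
    pathOK   : ∀ i → IsPathEdge C i → onPath φ i ≡ pathLabel C ch i
    -- f_k is the unique leg (index 0) of v_k, labelled φ(e_{i-2}) + 1
    lightOK  : ∀ i k → ch i ≡ just k → onLeg φ k 0 ≡ pathLabel C ch (i ∸ 2) + 1
    -- Step 2: r k is the index of the leg of heavy v_k left unlabelled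
    r        : ℕ → ℕ
    r<legs   : ∀ k → Heavy C ch k → r k < legs C k
  S2 : ℕ → ℕ → Set
  S2 k j = Heavy C ch k × j < legs C k × j ≢ r k
  field
    s2InL0   : ∀ k j → S2 k j → InL0 C (onLeg φ k j)
    s2Inj    : ∀ k j k′ j′ → S2 k j → S2 k′ j′ →
               onLeg φ k j ≡ onLeg φ k′ j′ → k ≡ k′ × j ≡ j′
    s2NewP   : ∀ k j i → S2 k j → IsPathEdge C i → onLeg φ k j ≢ onPath φ i
    s2NewL   : ∀ k j k′ → S2 k j → Light C ch k′ → onLeg φ k j ≢ onLeg φ k′ 0
  Unused : ℕ → Set
  Unused x = InL0 C x
    × (∀ i → IsPathEdge C i → onPath φ i ≢ x)
    × (∀ k → Light C ch k → onLeg φ k 0 ≢ x)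
    × (∀ k j → S2 k j → onLeg φ k j ≢ x)
  psum : ℕ → ℕ
  psum k = onPath φ k + onPath φ (suc k)
         + sumFrom 0 (legs C k) (λ j → if j ≡ᵇ r k then 0 else onLeg φ k j)
  field
    t        : ℕ
    w        : Fin t → ℕ
    wHeavy   : ∀ a → Heavy C ch (w a)
    wInj     : ∀ a b → w a ≡ w b → a ≡ b
    wSurj    : ∀ k → Heavy C ch k → ∃ λ a → w a ≡ k
    wSorted  : ∀ a b → a ≤ᶠ b → psum (w a) ≤ psum (w b)
    ℓ        : Fin t → ℕ
    ℓIncr    : ∀ a b → a <ᶠ b → ℓ a < ℓ b
    ℓEnum    : ∀ x → (∃ λ a → ℓ a ≡ x) ⇔ Unused x
    step3    : ∀ a → onLeg φ (w a) (r (w a)) ≡ ℓ a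

InImgE0F0 : Caterpillar → (ℕ → Maybe ℕ) → Labeling → ℕ → Set
InImgE0F0 C ch φ x =
  (∃ λ i → IsPathEdge C i × SameParity i (p C) × onPath φ i ≡ x)
  ⊎ (∃ λ k → Light C ch k × onLeg φ k 0 ≡ x)

InImgE1 : Caterpillar → Labeling → ℕ → Set
InImgE1 C φ x = ∃ λ i → IsPathEdge C i × ¬ SameParity i (p C) × onPath φ i ≡ x

-- E_2 = all legs not in F_0
InImgE2 : Caterpillar → (ℕ → Maybe ℕ) → Labeling → ℕ → Set
InImgE2 C ch φ x =
  ∃ λ k → ∃ λ j → IsLeg C k j × ¬ (Light C ch k × j ≡ 0) × onLeg φ k j ≡ x

module Submission where

-- Write q = p, M = m - ⌊q/2⌋ (the largest label of L_0) and L i = φ(e_i).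
-- Step 1 sets L i = L (i-2) + 1, plus one more exactly at an iteration i
-- that makes some v_k light, and such iterations have i ≡ q (mod 2).
-- Hence on E_1 the labels are M + ⌈i/2⌉; they increase strictly, so the
-- test φ(e_{i-1}) = φ(e_k) + φ(e_{k+1}) can succeed for v_k at one
-- iteration only, |U_i| grows exactly by the extra ones, and on E_0 the
-- labels are ⌈i/2⌉ + |U_i|.  Every light vertex has degree 3, i.e. exactly
-- one leg, so |U_q| is at most the number of legs and ⌈q/2⌉ + |U_q| ≤ M.
-- The images are obtained from one discrete intermediate-value lemma
-- (intervalCover): consecutive E_1 labels differ by 1, consecutive E_0
-- labels by 1 or by 2, the skipped value being the label of the leg f_k
-- that has just become light.  Finally the legs of E_2 carry exactly the
-- labels of L_0 missed by E_0 ∪ F_0 ∪ E_1: Step 2 only uses fresh labels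
-- of L_0, and Step 3 uses precisely the labels of L_0 left over.

open import Defs
open import Data.Nat using (ℕ; zero; suc; _+_; _∸_; _≤_; _<_; ⌊_/2⌋; ⌈_/2⌉; z≤n; s≤s; _≡ᵇ_)
open import Data.Nat.Properties
open import Data.Nat.DivMod using (_%_)
open import Data.Bool using (Bool; true; false; if_then_else_; _∨_; T)
open import Data.Bool.Properties using (∨-identityʳ; ∨-zeroʳ) renaming (_≟_ to _≟ᴮ_)
open import Data.Maybe using (Maybe; just; nothing)
open import Data.Product using (_×_; _,_; proj₁; proj₂; ∃)
open import Data.Sum using (_⊎_; inj₁; inj₂; [_,_]′)
open import Data.Empty using (⊥; ⊥-elim)
open import Data.Unit using (tt)
open import Relation.Nullary using (¬_; Dec; yes; no)
open import Relation.Nullary.Decidable using (_×-dec_; ¬?)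
open import Relation.Binary.PropositionalEquality
open import Relation.Binary.Definitions using (tri<; tri≈; tri>)
open import Function.Base using (id)
open import Function.Bundles using (_⇔_; mk⇔; Equivalence)

parity-01 : ∀ n → n % 2 ≡ 0 ⊎ n % 2 ≡ 1
parity-01 zero = inj₁ refl
parity-01 (suc zero) = inj₂ refl
parity-01 (suc (suc n)) = parity-01 n

parity-suc : ∀ n → n % 2 ≢ suc n % 2
parity-suc zero ()
parity-suc (suc zero) ()
parity-suc (suc (suc n)) = parity-suc n

parity-two-valued : ∀ a b c → a % 2 ≢ c % 2 → b % 2 ≢ c % 2 → a % 2 ≡ b % 2
parity-two-valued a b c a≢c b≢c with parity-01 a | parity-01 b | parity-01 c
... | inj₁ a0 | inj₁ b0 | _       = trans a0 (sym b0)
... | inj₂ a1 | inj₂ b1 | _       = trans a1 (sym b1)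
... | inj₁ a0 | inj₂ _  | inj₁ c0 = ⊥-elim (a≢c (trans a0 (sym c0)))
... | inj₁ _  | inj₂ b1 | inj₂ c1 = ⊥-elim (b≢c (trans b1 (sym c1)))
... | inj₂ _  | inj₁ b0 | inj₁ c0 = ⊥-elim (b≢c (trans b0 (sym c0)))
... | inj₂ a1 | inj₁ _  | inj₂ c1 = ⊥-elim (a≢c (trans a1 (sym c1)))

-- numbers of equal parity lie at distance ≥ 2, so ⌈_/2⌉ separates them
⌈/2⌉-strict-sameParity : ∀ a b → a % 2 ≡ b % 2 → a < b → ⌈ a /2⌉ < ⌈ b /2⌉
⌈/2⌉-strict-sameParity a b same a<b with suc a ≟ b
... | yes refl = ⊥-elim (parity-suc a same)
... | no 1+a≢b = ⌈n/2⌉-mono {suc (suc a)} {b} (≤∧≢⇒< a<b 1+a≢b)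

⌈/2⌉-injective-sameParity : ∀ a b → a % 2 ≡ b % 2 → ⌈ a /2⌉ ≡ ⌈ b /2⌉ → a ≡ b
⌈/2⌉-injective-sameParity a b same eq with <-cmp a b
... | tri< a<b _ _ = ⊥-elim (<⇒≢ (⌈/2⌉-strict-sameParity a b same a<b) eq)
... | tri≈ _ a≡b _ = a≡b
... | tri> _ _ b<a = ⊥-elim (<⇒≢ (⌈/2⌉-strict-sameParity b a (sym same) b<a) (sym eq))

≡ᵇ-true⇒≡ : ∀ m n → (m ≡ᵇ n) ≡ true → m ≡ n
≡ᵇ-true⇒≡ m n eq = ≡ᵇ⇒≡ m n (subst T (sym eq) tt)

≡ᵇ-refl : ∀ n → (n ≡ᵇ n) ≡ true
≡ᵇ-refl zero = refl
≡ᵇ-refl (suc n) = ≡ᵇ-refl n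

≢⇒≡ᵇ-false : ∀ m n → m ≢ n → (m ≡ᵇ n) ≡ false
≢⇒≡ᵇ-false m n m≢n with m ≡ᵇ n in eq
... | true = ⊥-elim (m≢n (≡ᵇ-true⇒≡ m n eq))
... | false = refl

indicator : Bool → ℕ
indicator b = if b then 1 else 0

countFrom-ext : ∀ n a (f g : ℕ → Bool) → (∀ k → a ≤ k → f k ≡ g k) →
  countFrom a n f ≡ countFrom a n g
countFrom-ext zero a f g f≗g = refl
countFrom-ext (suc n) a f g f≗g =
  cong₂ _+_ (cong indicator (f≗g a ≤-refl))
            (countFrom-ext n (suc a) f g (λ k a<k → f≗g k (<⇒≤ a<k)))

countFrom-none : ∀ n a (f : ℕ → Bool) → (∀ k → f k ≡ false) → countFrom a n f ≡ 0
countFrom-none zero a f none = refl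
countFrom-none (suc n) a f none =
  cong₂ _+_ (cong indicator (none a)) (countFrom-none n (suc a) f none)

countFrom-insert : ∀ n a (b : ℕ → Bool) k₀ → a ≤ k₀ → k₀ < a + n → b k₀ ≡ false →
  countFrom a n (λ k → b k ∨ (k₀ ≡ᵇ k)) ≡ countFrom a n b + 1
countFrom-insert zero a b k₀ a≤k₀ k₀<a+0 _ =
  ⊥-elim (<-irrefl (sym (+-identityʳ a)) (≤-<-trans a≤k₀ k₀<a+0))
countFrom-insert (suc n) a b k₀ a≤k₀ k₀<end new with a ≟ k₀
... | yes refl = begin
    indicator (b a ∨ (a ≡ᵇ a)) + countFrom (suc a) n (λ k → b k ∨ (a ≡ᵇ k))
      ≡⟨ cong₂ _+_ (cong (λ z → indicator (z ∨ (a ≡ᵇ a))) new)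
                   (countFrom-ext n (suc a) _ _ (λ k a<k →
                      trans (cong (b k ∨_) (≢⇒≡ᵇ-false a k (<⇒≢ a<k))) (∨-identityʳ (b k)))) ⟩
    indicator (a ≡ᵇ a) + countFrom (suc a) n b
      ≡⟨ cong (λ z → indicator z + countFrom (suc a) n b) (≡ᵇ-refl a) ⟩
    1 + countFrom (suc a) n b
      ≡⟨ +-comm 1 _ ⟩
    countFrom (suc a) n b + 1
      ≡⟨ cong (λ z → indicator z + countFrom (suc a) n b + 1) (sym new) ⟩
    indicator (b a) + countFrom (suc a) n b + 1 ∎
  where open ≡-Reasoning
... | no a≢k₀ = begin
    indicator (b a ∨ (k₀ ≡ᵇ a)) + countFrom (suc a) n (λ k → b k ∨ (k₀ ≡ᵇ k))
      ≡⟨ cong₂ _+_ (cong indicator (trans (cong (b a ∨_) (≢⇒≡ᵇ-false k₀ a (≢-sym a≢k₀)))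
                                          (∨-identityʳ (b a))))
                   (countFrom-insert n (suc a) b k₀ (≤∧≢⇒< a≤k₀ a≢k₀)
                                     (subst (k₀ <_) (+-suc a n) k₀<end) new) ⟩
    indicator (b a) + (countFrom (suc a) n b + 1)
      ≡⟨ sym (+-assoc (indicator (b a)) _ 1) ⟩
    indicator (b a) + countFrom (suc a) n b + 1 ∎
  where open ≡-Reasoning

countFrom-snoc : ∀ n a (b : ℕ → Bool) →
  countFrom a (suc n) b ≡ countFrom a n b + indicator (b (a + n))
countFrom-snoc zero a b rewrite +-identityʳ a = +-comm (indicator (b a)) 0
countFrom-snoc (suc n) a b rewrite +-suc a n =
  trans (cong (indicator (b a) +_) (countFrom-snoc n (suc a) b))
        (sym (+-assoc (indicator (b a)) _ _))

countFrom≤sumFrom : ∀ n a (b : ℕ → Bool) (f : ℕ → ℕ) → (∀ k → b k ≡ true → 1 ≤ f k) →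
  countFrom a n b ≤ sumFrom a n f
countFrom≤sumFrom zero a b f pos = z≤n
countFrom≤sumFrom (suc n) a b f pos =
  +-mono-≤ (indicator≤ (b a) refl) (countFrom≤sumFrom n (suc a) b f pos)
  where
  indicator≤ : ∀ x → b a ≡ x → indicator x ≤ f a
  indicator≤ true ba = pos a ba
  indicator≤ false _ = z≤n

count-interior≤sum : ∀ Q (b : ℕ → Bool) (f : ℕ → ℕ) → b 0 ≡ false → b Q ≡ false →
  (∀ k → b k ≡ true → 1 ≤ f k) → countFrom 0 (suc Q) b ≤ sumFrom 1 (Q ∸ 1) f
count-interior≤sum zero b f b0 _ _ = ≤-reflexive (cong (λ z → indicator z + 0) b0)
count-interior≤sum (suc Q) b f b0 bQ pos =
  ≤-trans (≤-reflexive dropEnds) (countFrom≤sumFrom Q 1 b f pos)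
  where
  open ≡-Reasoning
  dropEnds : countFrom 0 (suc (suc Q)) b ≡ countFrom 1 Q b
  dropEnds = begin
    indicator (b 0) + countFrom 1 (suc Q) b ≡⟨ cong (λ z → indicator z + countFrom 1 (suc Q) b) b0 ⟩
    countFrom 1 (suc Q) b                   ≡⟨ countFrom-snoc Q 1 b ⟩
    countFrom 1 Q b + indicator (b (suc Q)) ≡⟨ cong (λ z → countFrom 1 Q b + indicator z) bQ ⟩
    countFrom 1 Q b + 0                     ≡⟨ +-identityʳ _ ⟩
    countFrom 1 Q b ∎

no-value-between : ∀ {a x} → a < x → ¬ x < suc a
no-value-between a<x x<1+a = <⇒≱ a<x (≤-pred x<1+a)

≤-back-two : ∀ {n q} → 3 + n ≤ q → 1 + n ≤ q
≤-back-two 3+n≤q = ≤-trans (n≤1+n _) (≤-trans (n≤1+n _) 3+n≤q)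

only-value-between : ∀ {a x} → a < x → x < suc (suc a) → x ≡ suc a
only-value-between a<x x<2+a = ≤-antisym (≤-pred x<2+a) a<x

monotone-from-steps : (f : ℕ → ℕ) → (∀ n → f n ≤ f (suc n)) → ∀ {i j} → i ≤ j → f i ≤ f j
monotone-from-steps f step i≤j with m≤n⇒m<n∨m≡n i≤j
... | inj₂ refl = ≤-refl
... | inj₁ (s≤s i≤j′) = ≤-trans (monotone-from-steps f step i≤j′) (step _)

-- Discrete intermediate values for a sequence g read along a class of
-- positions closed under i ↦ i - 2 (Good).
intervalCover : (g : ℕ → ℕ) (Good P : ℕ → Set) (lo : ℕ) →
  (∀ n → Good (3 + n) → Good (1 + n)) →
  (∀ i → 1 ≤ i → i ≤ 2 → Good i → g i ≤ lo) →
  (∀ i → 1 ≤ i → Good i → P (g i)) →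
  (∀ n → Good (3 + n) → ∀ x → g (1 + n) < x → x < g (3 + n) → P x) →
  ∀ i → 1 ≤ i → Good i → ∀ x → lo ≤ x → x ≤ g i → P x
intervalCover g Good P lo down start hit gap = cover
  where
  atStart : ∀ i → 1 ≤ i → i ≤ 2 → Good i → ∀ x → lo ≤ x → x ≤ g i → P x
  atStart i 1≤i i≤2 good x lo≤x x≤gi =
    subst P (≤-antisym (≤-trans (start i 1≤i i≤2 good) lo≤x) x≤gi) (hit i 1≤i good)

  cover : ∀ i → 1 ≤ i → Good i → ∀ x → lo ≤ x → x ≤ g i → P x
  cover zero ()
  cover (suc zero) 1≤i = atStart 1 1≤i (s≤s z≤n)
  cover (suc (suc zero)) 1≤i = atStart 2 1≤i (s≤s (s≤s z≤n))
  cover (suc (suc (suc n))) 1≤i good x lo≤x x≤gi =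
    [ (λ x<gi → [ cover (suc n) (s≤s z≤n) (down n good) x lo≤x
                , (λ prev<x → gap n good x prev<x x<gi)
                ]′ (≤-<-connex x (g (1 + n))))
    , (λ x≡gi → subst P (sym x≡gi) (hit (3 + n) 1≤i good))
    ]′ (m≤n⇒m<n∨m≡n x≤gi)

edges∸⌊p/2⌋ : ∀ C → edges C ∸ ⌊ p C /2⌋ ≡ ⌈ p C /2⌉ + sumFrom 1 (p C ∸ 1) (legs C)
edges∸⌊p/2⌋ C = begin
    (q + S) ∸ ⌊ q /2⌋
      ≡⟨ cong (λ y → (y + S) ∸ ⌊ q /2⌋) (sym (⌊n/2⌋+⌈n/2⌉≡n q)) ⟩
    (⌊ q /2⌋ + ⌈ q /2⌉ + S) ∸ ⌊ q /2⌋
      ≡⟨ cong (_∸ ⌊ q /2⌋) (trans (+-assoc ⌊ q /2⌋ _ S) (+-comm ⌊ q /2⌋ _)) ⟩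
    (⌈ q /2⌉ + S + ⌊ q /2⌋) ∸ ⌊ q /2⌋ ≡⟨ m+n∸n≡m (⌈ q /2⌉ + S) ⌊ q /2⌋ ⟩
    ⌈ q /2⌉ + S ∎
  where
  open ≡-Reasoning
  q S : ℕ
  q = p C
  S = sumFrom 1 (p C ∸ 1) (legs C)

edges∸⌊p/2⌋+⌊p/2⌋ : ∀ C → edges C ∸ ⌊ p C /2⌋ + ⌊ p C /2⌋ ≡ edges C
edges∸⌊p/2⌋+⌊p/2⌋ C = m∸n+n≡m (≤-trans (⌊n/2⌋≤n (p C)) (m≤m+n (p C) _))

deg-internal : ∀ C k → IsInternal C k → deg C k ≡ 2 + legs C k
deg-internal C (suc k) (_ , k<p) with suc k ≡ᵇ p C in eq
... | true = ⊥-elim (<-irrefl (≡ᵇ-true⇒≡ (suc k) (p C) eq) k<p)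
... | false = refl

deg≡3⇒oneLeg : ∀ C k → 1 ≤ k → deg C k ≡ 3 → legs C k ≡ 1
deg≡3⇒oneLeg C (suc k) _ d with suc k ≡ᵇ p C
... | false = suc-injective (suc-injective d)

-- Step 1: the labels of the path edges and the sets U_i

module Step1 (C : Caterpillar) {ch : ℕ → Maybe ℕ} (valid : ValidChoices C ch) where

  q M : ℕ
  q = p C
  M = edges C ∸ ⌊ q /2⌋

  L U : ℕ → ℕ
  L = pathLabel C ch
  U = cardU C ch

  Sp : ℕ → Set
  Sp i = SameParity i q

  1≤q : 1 ≤ q
  1≤q = ≤-trans (s≤s z≤n) (2≤p C)

  chosen : ∀ i k → ch i ≡ just k → 3 ≤ i × i ≤ q × Sp i × Candidate C ch i k
  chosen = ValidChoices.chosen valid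

  silent-early : ∀ i → i < 3 → ch i ≡ nothing
  silent-early i i<3 with ch i in eq
  ... | nothing = refl
  ... | just k = ⊥-elim (<⇒≱ i<3 (proj₁ (chosen i k eq)))

  silent-offParity : ∀ i → ¬ Sp i → ch i ≡ nothing
  silent-offParity i ¬sp with ch i in eq
  ... | nothing = refl
  ... | just k = ⊥-elim (¬sp (proj₁ (proj₂ (proj₂ (chosen i k eq)))))

  ¬Sp-pred : ∀ n → Sp (suc n) → ¬ Sp n
  ¬Sp-pred n sp-1+n sp-n = parity-suc n (trans sp-n (sym sp-1+n))

  label-gap : ∀ n → L (3 + n) ≡ suc (L (1 + n)) + bump (ch (3 + n))
  label-gap n = cong (_+ bump (ch (3 + n))) (+-comm (L (1 + n)) 1)

  initial-E0 : ∀ i → 1 ≤ i → i ≤ 2 → Sp i → L i ≡ 1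
  initial-E0 (suc zero) _ _ sp = cong (λ b → if b then 1 else suc M) (cong (_≡ᵇ 1) (sym sp))
  initial-E0 (suc (suc zero)) _ _ sp = cong (λ b → if b then suc M else 1) (cong (_≡ᵇ 1) (sym sp))
  initial-E0 (suc (suc (suc _))) _ (s≤s (s≤s ())) _

  initial-E1 : ∀ i → 1 ≤ i → i ≤ 2 → ¬ Sp i → L i ≡ suc M
  initial-E1 (suc zero) _ _ ¬sp with parity-01 q
  ... | inj₁ q0 = cong (λ b → if b then 1 else suc M) (cong (_≡ᵇ 1) q0)
  ... | inj₂ q1 = ⊥-elim (¬sp (sym q1))
  initial-E1 (suc (suc zero)) _ _ ¬sp with parity-01 q
  ... | inj₁ q0 = ⊥-elim (¬sp (sym q0))
  ... | inj₂ q1 = cong (λ b → if b then suc M else 1) (cong (_≡ᵇ 1) q1)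
  initial-E1 (suc (suc (suc _))) _ (s≤s (s≤s ())) _

  labelE1 : ∀ i → 1 ≤ i → i ≤ q → ¬ Sp i → L i ≡ M + ⌈ i /2⌉
  labelE1 (suc zero) 1≤i _ ¬sp = trans (initial-E1 1 1≤i (s≤s z≤n) ¬sp) (+-comm 1 M)
  labelE1 (suc (suc zero)) 1≤i _ ¬sp = trans (initial-E1 2 1≤i (s≤s (s≤s z≤n)) ¬sp) (+-comm 1 M)
  labelE1 (suc (suc (suc n))) _ i≤q ¬sp = begin
      L (3 + n)                         ≡⟨ label-gap n ⟩
      suc (L (1 + n)) + bump (ch (3 + n))
        ≡⟨ cong (λ c → suc (L (1 + n)) + bump c) (silent-offParity (3 + n) ¬sp) ⟩
      suc (L (1 + n)) + 0               ≡⟨ +-identityʳ _ ⟩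
      suc (L (1 + n))                   ≡⟨ cong suc (labelE1 (suc n) (s≤s z≤n) (≤-back-two i≤q) ¬sp) ⟩
      suc (M + ⌈ 1 + n /2⌉)             ≡⟨ sym (+-suc M _) ⟩
      M + ⌈ 3 + n /2⌉ ∎
    where open ≡-Reasoning

  chosen-trigger : ∀ i k → ch (suc i) ≡ just k →
    1 ≤ i × i ≤ q × ¬ Sp i × L i ≡ L k + L (suc k)
  chosen-trigger i k c with chosen (suc i) k c
  ... | s≤s 2≤i , 1+i≤q , sp , (_ , _ , _ , sum) =
    ≤-trans (s≤s z≤n) 2≤i , ≤-trans (n≤1+n i) 1+i≤q , ¬Sp-pred i sp , sum

  -- E_1 labels are distinct, so a vertex is chosen at one iteration at most
  chosen-unique : ∀ i j k → ch (suc i) ≡ just k → ch (suc j) ≡ just k → i ≡ j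
  chosen-unique i j k ci cj with chosen-trigger i k ci | chosen-trigger j k cj
  ... | 1≤i , i≤q , ¬spi , sumi | 1≤j , j≤q , ¬spj , sumj =
    ⌈/2⌉-injective-sameParity i j (parity-two-valued i j q ¬spi ¬spj)
      (+-cancelˡ-≡ M _ _ (begin
        M + ⌈ i /2⌉    ≡⟨ sym (labelE1 i 1≤i i≤q ¬spi) ⟩
        L i            ≡⟨ trans sumi (sym sumj) ⟩
        L j            ≡⟨ labelE1 j 1≤j j≤q ¬spj ⟩
        M + ⌈ j /2⌉ ∎))
    where open ≡-Reasoning

  isJustEq⇒≡ : ∀ c k → isJustEq c k ≡ true → c ≡ just k
  isJustEq⇒≡ (just j) k eq = cong just (≡ᵇ-true⇒≡ j k eq)

  inU⇒chosen : ∀ i k → inU ch i k ≡ true → ∃ λ j → j ≤ i × ch j ≡ just k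
  inU⇒chosen zero k eq = 0 , z≤n , isJustEq⇒≡ (ch 0) k eq
  inU⇒chosen (suc i) k eq with inU ch i k in before
  ... | true = let (j , j≤i , cj) = inU⇒chosen i k before in j , m≤n⇒m≤1+n j≤i , cj
  ... | false = suc i , ≤-refl , isJustEq⇒≡ (ch (suc i)) k eq

  chosen⇒isJustEq : ∀ {c} k → c ≡ just k → isJustEq c k ≡ true
  chosen⇒isJustEq k refl = ≡ᵇ-refl k

  chosen⇒inU : ∀ i j k → ch j ≡ just k → j ≤ i → inU ch i k ≡ true
  chosen⇒inU zero .zero k cj z≤n = chosen⇒isJustEq k cj
  chosen⇒inU (suc i) j k cj j≤1+i with m≤n⇒m<n∨m≡n j≤1+i
  ... | inj₂ refl = trans (cong (inU ch i k ∨_) (chosen⇒isJustEq k cj)) (∨-zeroʳ _)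
  ... | inj₁ (s≤s j≤i) = cong (_∨ isJustEq (ch (suc i)) k) (chosen⇒inU i j k cj j≤i)

  chosen-new : ∀ i k → ch (suc i) ≡ just k → inU ch i k ≡ false
  chosen-new i k c with inU ch i k in eq
  ... | false = refl
  ... | true with inU⇒chosen i k eq
  ...   | zero , _ , c0 = ⊥-elim (<⇒≱ (s≤s z≤n) (proj₁ (chosen 0 k c0)))
  ...   | suc j , j<i , cj = ⊥-elim (<-irrefl (chosen-unique j i k cj c) j<i)

  U-step : ∀ i → U (suc i) ≡ U i + bump (ch (suc i))
  U-step i with ch (suc i) in c
  ... | nothing = begin
      countFrom 0 (suc q) (λ k → inU ch i k ∨ false)
        ≡⟨ countFrom-ext (suc q) 0 _ _ (λ k _ → ∨-identityʳ _) ⟩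
      U i     ≡⟨ sym (+-identityʳ _) ⟩
      U i + 0 ∎
    where open ≡-Reasoning
  ... | just k₀ = countFrom-insert (suc q) 0 (inU ch i) k₀ z≤n k₀<1+q (chosen-new i k₀ c)
    where
    k₀<1+q : k₀ < suc q
    k₀<1+q with chosen (suc i) k₀ c
    ... | _ , 1+i≤q , _ , (_ , k₀≤i∸2 , _ , _) =
      s≤s (≤-trans k₀≤i∸2 (≤-trans (m∸n≤m (suc i) 3) 1+i≤q))

  U-early : ∀ i → i < 3 → U i ≡ 0
  U-early zero _ = countFrom-none (suc q) 0 _ (λ k → cong (λ c → isJustEq c k) (silent-early 0 (s≤s z≤n)))
  U-early (suc i) (s≤s i<2) = begin
      U (suc i)                   ≡⟨ U-step i ⟩
      U i + bump (ch (suc i))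
        ≡⟨ cong₂ (λ u c → u + bump c) (U-early i (m≤n⇒m≤1+n i<2)) (silent-early (suc i) (s≤s i<2)) ⟩
      0 ∎
    where open ≡-Reasoning

  U-mono : ∀ {i j} → i ≤ j → U i ≤ U j
  U-mono = monotone-from-steps U (λ i → ≤-trans (m≤m+n (U i) _) (≤-reflexive (sym (U-step i))))

  -- between two consecutive iterations of the parity of q, only the second can choose
  U-twoSteps : ∀ n → Sp (3 + n) → U (3 + n) ≡ U (1 + n) + bump (ch (3 + n))
  U-twoSteps n sp = begin
      U (3 + n)                                        ≡⟨ U-step (2 + n) ⟩
      U (2 + n) + bump (ch (3 + n))                    ≡⟨ cong (_+ bump (ch (3 + n))) (U-step (1 + n)) ⟩
      U (1 + n) + bump (ch (2 + n)) + bump (ch (3 + n))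
        ≡⟨ cong (λ c → U (1 + n) + bump c + bump (ch (3 + n))) (silent-offParity (2 + n) (¬Sp-pred (2 + n) sp)) ⟩
      U (1 + n) + 0 + bump (ch (3 + n))                ≡⟨ cong (_+ bump (ch (3 + n))) (+-identityʳ _) ⟩
      U (1 + n) + bump (ch (3 + n)) ∎
    where open ≡-Reasoning

  labelE0 : ∀ i → 1 ≤ i → i ≤ q → Sp i → L i ≡ ⌈ i /2⌉ + U i
  labelE0 (suc zero) 1≤i _ sp =
    trans (initial-E0 1 1≤i (s≤s z≤n) sp) (cong (1 +_) (sym (U-early 1 (s≤s (s≤s z≤n)))))
  labelE0 (suc (suc zero)) 1≤i _ sp =
    trans (initial-E0 2 1≤i (s≤s (s≤s z≤n)) sp) (cong (1 +_) (sym (U-early 2 (s≤s (s≤s (s≤s z≤n))))))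
  labelE0 (suc (suc (suc n))) _ i≤q sp = begin
      L (3 + n)                                      ≡⟨ label-gap n ⟩
      suc (L (1 + n)) + bump (ch (3 + n))
        ≡⟨ cong (λ l → suc l + bump (ch (3 + n))) (labelE0 (suc n) (s≤s z≤n) (≤-back-two i≤q) sp) ⟩
      suc (⌈ 1 + n /2⌉ + U (1 + n)) + bump (ch (3 + n)) ≡⟨ cong suc (+-assoc ⌈ 1 + n /2⌉ (U (1 + n)) _) ⟩
      ⌈ 3 + n /2⌉ + (U (1 + n) + bump (ch (3 + n)))  ≡⟨ cong (⌈ 3 + n /2⌉ +_) (sym (U-twoSteps n sp)) ⟩
      ⌈ 3 + n /2⌉ + U (3 + n) ∎
    where open ≡-Reasoning

  Top : ℕ
  Top = ⌈ q /2⌉ + U q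

  label-last : L q ≡ Top
  label-last = labelE0 q 1≤q ≤-refl refl

  labelE0≤Top : ∀ i → 1 ≤ i → i ≤ q → Sp i → L i ≤ Top
  labelE0≤Top i 1≤i i≤q sp =
    subst (_≤ Top) (sym (labelE0 i 1≤i i≤q sp)) (+-mono-≤ (⌈n/2⌉-mono i≤q) (U-mono i≤q))

  -- a light vertex was chosen, so it is internal of degree 3: it has exactly one leg
  light⇒oneLeg : ∀ k → inU ch q k ≡ true → IsInternal C k × legs C k ≡ 1
  light⇒oneLeg k light with inU⇒chosen q k light
  ... | j , j≤q , cj with chosen j k cj
  ...   | 3≤j , _ , _ , (1≤k , k≤j∸3 , deg3 , _) =
    (1≤k , <-≤-trans (≤-<-trans k≤j∸3 (∸-monoʳ-< {j} {3} {0} (s≤s z≤n) 3≤j)) j≤q) ,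
    deg≡3⇒oneLeg C k 1≤k deg3

  U≤legs : U q ≤ sumFrom 1 (q ∸ 1) (legs C)
  U≤legs = count-interior≤sum q (inU ch q) (legs C)
             (notLight 0 (λ ()))
             (notLight q (λ (_ , q<q) → <-irrefl refl q<q))
             (λ k light → ≤-reflexive (sym (proj₂ (light⇒oneLeg k light))))
    where
    notLight : ∀ k → ¬ IsInternal C k → inU ch q k ≡ false
    notLight k external with inU ch q k in eq
    ... | false = refl
    ... | true = ⊥-elim (external (proj₁ (light⇒oneLeg k eq)))

  Top≤M : Top ≤ M
  Top≤M = subst (Top ≤_) (sym (edges∸⌊p/2⌋ C)) (+-monoʳ-≤ ⌈ q /2⌉ U≤legs)

-- The images of φ on E_0 ∪ F_0, E_1 and E_2

module Images (C : Caterpillar) (φ : Labeling) (run : Produced C φ) where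
  open Produced run
  open Step1 C valid

  pathE0 : ∀ i → IsPathEdge C i → Sp i → onPath φ i ≡ ⌈ i /2⌉ + U i
  pathE0 i (1≤i , i≤q) sp = trans (pathOK i (1≤i , i≤q)) (labelE0 i 1≤i i≤q sp)

  pathE1 : ∀ i → IsPathEdge C i → ¬ Sp i → onPath φ i ≡ M + ⌈ i /2⌉
  pathE1 i (1≤i , i≤q) ¬sp = trans (pathOK i (1≤i , i≤q)) (labelE1 i 1≤i i≤q ¬sp)

  -- the leg f_k of a light v_k chosen at iteration j is labelled
  -- φ(e_{j-2}) + 1, a value skipped between the E_0 labels of e_{j-2}, e_j
  lightLeg-label : ∀ n k → ch (3 + n) ≡ just k → onLeg φ k 0 ≡ suc (L (1 + n))
  lightLeg-label n k c = trans (lightOK (3 + n) k c) (+-comm (L (1 + n)) 1)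

  lightLeg-inRange : ∀ k → Light C ch k → 1 ≤ onLeg φ k 0 × onLeg φ k 0 ≤ Top
  lightLeg-inRange k light with inU⇒chosen q k light
  ... | j , j≤q , cj with chosen j k cj
  ...   | s≤s (s≤s (s≤s {n = n} _)) , _ , sp , _ =
    subst (1 ≤_) (sym (lightLeg-label n k cj)) (s≤s z≤n) ,
    (begin
      onLeg φ k 0                      ≡⟨ lightLeg-label n k cj ⟩
      suc (L (1 + n))                  ≤⟨ m≤m+n _ _ ⟩
      suc (L (1 + n)) + bump (ch (3 + n)) ≡⟨ sym (label-gap n) ⟩
      L (3 + n)                        ≤⟨ labelE0≤Top (3 + n) (s≤s z≤n) j≤q sp ⟩
      Top ∎)
    where open ≤-Reasoning

  imgE0F0⇒ : ∀ x → InImgE0F0 C ch φ x → 1 ≤ x × x ≤ Top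
  imgE0F0⇒ x (inj₁ (i , pe , sp , eq)) =
    subst (1 ≤_) (trans (sym (pathE0 i pe sp)) eq) (≤-trans (⌈n/2⌉-mono (proj₁ pe)) (m≤m+n ⌈ i /2⌉ _)) ,
    subst (_≤ Top) (trans (sym (pathOK i pe)) eq) (labelE0≤Top i (proj₁ pe) (proj₂ pe) sp)
  imgE0F0⇒ x (inj₂ (k , light , eq)) = subst (λ y → 1 ≤ y × y ≤ Top) eq (lightLeg-inRange k light)

  imgE0F0⇐ : ∀ x → 1 ≤ x × x ≤ Top → InImgE0F0 C ch φ x
  imgE0F0⇐ x (1≤x , x≤Top) =
    intervalCover L Good (InImgE0F0 C ch φ) 1
      (λ n (3+n≤q , sp) → ≤-back-two 3+n≤q , sp)
      (λ i 1≤i i≤2 (_ , sp) → ≤-reflexive (initial-E0 i 1≤i i≤2 sp))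
      (λ i 1≤i (i≤q , sp) → inj₁ (i , (1≤i , i≤q) , sp , pathOK i (1≤i , i≤q)))
      gap q 1≤q (≤-refl , refl) x 1≤x (subst (x ≤_) (sym label-last) x≤Top)
    where
    Good : ℕ → Set
    Good i = i ≤ q × Sp i

    -- the only value skipped by E_0 is the label of the leg made light
    gap : ∀ n → Good (3 + n) → ∀ y → L (1 + n) < y → y < L (3 + n) → InImgE0F0 C ch φ y
    gap n (3+n≤q , _) y lo hi with ch (3 + n) in c | label-gap n
    ... | nothing | step = ⊥-elim (no-value-between lo (subst (y <_) (trans step (+-identityʳ _)) hi))
    ... | just k | step =
      inj₂ (k , chosen⇒inU q (3 + n) k c 3+n≤q ,
            trans (lightLeg-label n k c)
                  (sym (only-value-between lo (subst (y <_) (trans step (+-comm _ 1)) hi))))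

  imgE1⇒ : ∀ x → InImgE1 C φ x → InL1 C x
  imgE1⇒ x (i , pe , ¬sp , eq) =
    subst (suc M ≤_) x≡ (subst (_≤ M + ⌈ i /2⌉) (+-comm M 1) (+-monoʳ-≤ M (⌈n/2⌉-mono (proj₁ pe)))) ,
    subst (_≤ edges C) x≡ (≤-trans (+-monoʳ-≤ M (⌊n/2⌋-mono i<q)) (≤-reflexive (edges∸⌊p/2⌋+⌊p/2⌋ C)))
    where
    x≡ : M + ⌈ i /2⌉ ≡ x
    x≡ = trans (sym (pathE1 i pe ¬sp)) eq
    i<q : i < q
    i<q = ≤∧≢⇒< (proj₂ pe) (λ i≡q → ¬sp (cong (_% 2) i≡q))

  imgE1⇐ : ∀ x → InL1 C x → InImgE1 C φ x
  imgE1⇐ x (M<x , x≤m) =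
    intervalCover L Good (InImgE1 C φ) (suc M)
      (λ n (3+n≤q , ¬sp) → ≤-back-two 3+n≤q , ¬sp)
      (λ i 1≤i i≤2 (_ , ¬sp) → ≤-reflexive (initial-E1 i 1≤i i≤2 ¬sp))
      (λ i 1≤i (i≤q , ¬sp) → i , (1≤i , i≤q) , ¬sp , pathOK i (1≤i , i≤q))
      gap (q ∸ 1) 1≤q-1 (q-1≤q , ¬Sp-q-1)
      x M<x (subst (x ≤_) (sym last-E1) x≤m)
    where
    Good : ℕ → Set
    Good i = i ≤ q × ¬ Sp i

    q-1+1 : suc (q ∸ 1) ≡ q
    q-1+1 = trans (+-comm 1 (q ∸ 1)) (m∸n+n≡m 1≤q)

    1≤q-1 : 1 ≤ q ∸ 1
    1≤q-1 = ∸-monoˡ-≤ 1 (2≤p C)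

    q-1≤q : q ∸ 1 ≤ q
    q-1≤q = m∸n≤m q 1

    ¬Sp-q-1 : ¬ Sp (q ∸ 1)
    ¬Sp-q-1 = ¬Sp-pred (q ∸ 1) (subst Sp (sym q-1+1) refl)

    last-E1 : L (q ∸ 1) ≡ edges C
    last-E1 = trans (labelE1 (q ∸ 1) 1≤q-1 q-1≤q ¬Sp-q-1)
                    (trans (cong (λ z → M + ⌊ z /2⌋) q-1+1) (edges∸⌊p/2⌋+⌊p/2⌋ C))

    -- E_1 labels are consecutive
    gap : ∀ n → Good (3 + n) → ∀ y → L (1 + n) < y → y < L (3 + n) → InImgE1 C φ y
    gap n (_ , ¬sp) y lo hi =
      ⊥-elim (no-value-between lo (subst (y <_) (trans (label-gap n)
        (trans (cong (λ c → suc (L (1 + n)) + bump c) (silent-offParity (3 + n) ¬sp)) (+-identityʳ _))) hi))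

  Fresh : ℕ → Set
  Fresh x = InL0 C x × (∀ i → IsPathEdge C i → onPath φ i ≢ x)
          × (∀ k → Light C ch k → onLeg φ k 0 ≢ x)

  -- all of [1, Top] is taken by E_0 ∪ F_0
  fresh⇒aboveTop : ∀ x → Fresh x → Top < x
  fresh⇒aboveTop x ((1≤x , _) , notPath , notLight) with ≤-<-connex x Top
  ... | inj₂ Top<x = Top<x
  ... | inj₁ x≤Top with imgE0F0⇐ x (1≤x , x≤Top)
  ...   | inj₁ (i , pe , _ , eq) = ⊥-elim (notPath i pe eq)
  ...   | inj₂ (k , light , eq) = ⊥-elim (notLight k light eq)

  unlit⇒heavy : ∀ k j → IsLeg C k j → inU ch q k ≡ false → Heavy C ch k
  unlit⇒heavy k j (int , j<legs) unlit =
    int , subst (3 ≤_) (sym (deg-internal C k int)) (s≤s (s≤s (≤-trans (s≤s z≤n) j<legs))) , unlit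

  heavy⇒¬light : ∀ {k} → Heavy C ch k → ¬ Light C ch k
  heavy⇒¬light (_ , _ , unlit) light with trans (sym light) unlit
  ... | ()

  -- Step 2 labels are fresh by construction, Step 3 labels by the choice of ℓ
  imgE2⇒fresh : ∀ x → InImgE2 C ch φ x → Fresh x
  imgE2⇒fresh x (k , j , leg , notF0 , eq) with inU ch q k in lit
  ... | true = ⊥-elim (notF0 (refl , n<1⇒n≡0 (subst (j <_) (proj₂ (light⇒oneLeg k lit)) (proj₂ leg))))
  ... | false with j ≟ r k
  ...   | no j≢r = subst (InL0 C) eq (s2InL0 k j step2) ,
                   (λ i pe h → s2NewP k j i step2 pe (trans eq (sym h))) ,
                   (λ k′ light h → s2NewL k j k′ step2 light (trans eq (sym h)))
    where
    step2 : S2 k j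
    step2 = unlit⇒heavy k j leg lit , proj₂ leg , j≢r
  ...   | yes refl with wSurj k (unlit⇒heavy k j leg lit)
  ...     | a , refl with Equivalence.to (ℓEnum (ℓ a)) (a , refl)
  ...       | inL0 , notPath , notLight , _ = subst Fresh (trans (sym (step3 a)) eq) (inL0 , notPath , notLight)

  imgE2⇒ : ∀ x → InImgE2 C ch φ x → suc Top ≤ x × x ≤ M
  imgE2⇒ x e2 = fresh⇒aboveTop x fresh , proj₂ (proj₁ fresh)
    where
    fresh : Fresh x
    fresh = imgE2⇒fresh x e2

  -- a value in (Top, M] is either a Step 2 label or unused after Step 2,
  -- in which case Step 3 puts it on the remaining leg of some heavy w a
  step2? : ∀ x k j → Dec (S2 k j × onLeg φ k j ≡ x)
  step2? x k j = ((((1 ≤? k) ×-dec (k <? q)) ×-dec (3 ≤? deg C k) ×-dec (inU ch q k ≟ᴮ false))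
                  ×-dec (j <? legs C k) ×-dec ¬? (j ≟ r k)) ×-dec (onLeg φ k j ≟ x)

  imgE2⇐ : ∀ x → suc Top ≤ x × x ≤ M → InImgE2 C ch φ x
  imgE2⇐ x (Top<x , x≤M) with anyUpTo? (λ k → anyUpTo? (step2? x k) (legs C k)) q
  ... | yes (k , _ , j , _ , (heavy , j<legs , _) , eq) =
    k , j , (proj₁ heavy , j<legs) , (λ (light , _) → heavy⇒¬light heavy light) , eq
  ... | no notStep2 with Equivalence.from (ℓEnum x) unused
    where
    unused : Unused x
    unused = (≤-trans (s≤s z≤n) Top<x , x≤M) ,
             (λ i pe eq → notPathLabel i pe eq (i % 2 ≟ q % 2)) ,
             (λ k light eq → <⇒≱ Top<x (proj₂ (imgE0F0⇒ x (inj₂ (k , light , eq))))) ,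
             (λ k j s2 eq → notStep2 (k , proj₂ (proj₁ (proj₁ s2)) , j , proj₁ (proj₂ s2) , s2 , eq))
      where
      notPathLabel : ∀ i → IsPathEdge C i → onPath φ i ≡ x → Dec (Sp i) → ⊥
      notPathLabel i pe eq (yes sp) = <⇒≱ Top<x (proj₂ (imgE0F0⇒ x (inj₁ (i , pe , sp , eq))))
      notPathLabel i pe eq (no ¬sp) = <⇒≱ (s≤s x≤M) (proj₁ (imgE1⇒ x (i , pe , ¬sp , eq)))
  ... | a , ℓa≡x =
    w a , r (w a) , (proj₁ (wHeavy a) , r<legs (w a) (wHeavy a)) ,
    (λ (light , _) → heavy⇒¬light (wHeavy a) light) , trans (step3 a) ℓa≡x

lemma1 : (C : Caterpillar) (φ : Labeling) (run : Produced C φ) →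
    let m = edges C
        q = p C
        ch = Produced.ch run
    in (∀ i → IsPathEdge C i →
          (SameParity i q → onPath φ i ≡ ⌈ i /2⌉ + cardU C ch i)
          × (¬ SameParity i q → onPath φ i ≡ m ∸ ⌊ q /2⌋ + ⌈ i /2⌉))
       × ((∀ x → InImgE0F0 C ch φ x ⇔ (1 ≤ x × x ≤ ⌈ q /2⌉ + cardU C ch q))
          × (∀ x → 1 ≤ x → x ≤ ⌈ q /2⌉ + cardU C ch q → InL0 C x))
       × (∀ x → InImgE1 C φ x ⇔ InL1 C x)
       × (∀ x → InL1 C x ⇔ (suc (m ∸ ⌊ q /2⌋) ≤ x × x ≤ m))
       × ((∀ x → InImgE2 C ch φ x ⇔
              (suc (⌈ q /2⌉ + cardU C ch q) ≤ x × x ≤ m ∸ ⌊ q /2⌋))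
          × (∀ x → suc (⌈ q /2⌉ + cardU C ch q) ≤ x → x ≤ m ∸ ⌊ q /2⌋ → InL0 C x))
lemma1 C φ run =
  (λ i pe → pathE0 i pe , pathE1 i pe) ,
  ((λ x → mk⇔ (imgE0F0⇒ x) (imgE0F0⇐ x)) , (λ x 1≤x x≤Top → 1≤x , ≤-trans x≤Top Top≤M)) ,
  (λ x → mk⇔ (imgE1⇒ x) (imgE1⇐ x)) ,
  (λ x → mk⇔ id id) ,
  ((λ x → mk⇔ (imgE2⇒ x) (imgE2⇐ x)) , (λ x Top<x x≤M → ≤-trans (s≤s z≤n) Top<x , x≤M))
  where
  open Images C φ run
  open Step1 C (Produced.valid run)
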